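{- Let $T$ be a hook composition tableau of shape $\beta$ and let $x\in\mathcal{A}\cup\mathcal{A}'$. If $\beta_i>\beta_j$ for some $i<j$, then in $T\leftarrow x$ the row that was row $i$ of $T$ is still strictly longer than the row that was row $j$ of $T$.
   Context: Fix $k,l\ge0$, $\mathcal{A}=\{1,\dots,k\}$, $\mathcal{A}'=\{1',\dots,l'\}$, totally ordered $1<\dots<k<1'<\dots<l'$; $\infty$ exceeds every letter and lies in neither alphabet. French notation: row $i$ is the $i$-th from the bottom, cell $(i,j)$ is row $i$, column $j$. A composition $\beta=(\beta_1,\dots,\beta_r)$ with largest part $m$ has $\beta_i$ cells in row $i$. Hook composition tableau (HCT) of shape $\beta$: filling $F$ with letters of $\mathcal{A}\cup\mathcal{A}'$ such that rows weakly increase; unprimed entries weakly and primed strictly increase along rows; in the leftmost column unprimed entries strictly and primed weakly increase bottom to top; and with $\hat F$ the $r\times m$ array with $\infty$ in missing cells, for $1\le i<j\le r$, $1\le n<m$: (a) if $\hat F(i,n+1)\in\mathcal{A}$ and $\hat F(i,n+1)\ge\hat F(j,n)$ then $\hat F(i,n+1)>\hat F(j,n+1)$; (b) if $\hat F(i,n+1)\in\mathcal{A}'$ and $\hat F(i,n+1)>\hat F(j,n)$ then $\hat F(i,n+1)\ge\hat F(j,n+1)$. Reading order: down each column top to bottom, from the rightmost column leftwards. Insertion $F\leftarrow x$: pad $F$ with $\infty$ in all cells $(i,j)$ with $\beta_i<j\le m+1$ and scan in reading order. If $x\in\mathcal{A}$, $x$ bumps (replaces) the first scanned entry $\hat F(i,j)$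 with $j\ne1$, $\hat F(i,j)>x$, $\hat F(i,j-1)\le x$; if none, $x$ forms a new row of length 1 inserted in the first column between rows $i,i+1$ with $\hat F(i,1)<x<\hat F(i+1,1)$, or at the bottom if $x<\hat F(1,1)$. If $x\in\mathcal{A}'$, $x$ bumps the first scanned entry with $j\ne1$, $\hat F(i,j)\ge x$, $\hat F(i,j-1)<x$; if none, $x$ forms a new row of length 1 between rows with $\hat F(i,1)<x\le\hat F(i+1,1)$, or at the bottom if $x\le\hat F(i,1)$ for all $i$. If the bumped entry is $\infty$ or a new row was created, stop; otherwise the bumped entry becomes the new $x$ and scanning continues from the cell immediately after $(i,j)$ in reading order. -}

module Defs where

open import Data.Nat.Base using (ℕ; zero; suc; _+_; _<_; _≤_; _⊔_; _<ᵇ_; _≤ᵇ_; pred)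
open import Data.Fin.Base using (Fin; toℕ)
open import Data.Bool.Base using (Bool; true; false; if_then_else_; _∧_)
open import Data.List.Base using (List; []; _∷_; length; map; concatMap; reverse; upTo; foldr)
open import Data.Maybe.Base using (Maybe; just; nothing)
open import Data.Product.Base using (_×_; _,_; proj₁; proj₂)
open import Data.Sum.Base using (_⊎_)
open import Relation.Binary.PropositionalEquality using (_≡_)

-- Letters: unprimed alphabet {1..k} (un a) and primed alphabet {1'..l'} (pr b),
-- totally ordered 1 < ... < k < 1' < ... < l'.
data Ltr (k l : ℕ) : Set where
  un : Fin k → Ltr k l
  pr : Fin l → Ltr k l

data Ext (k l : ℕ) : Set where
  fin : Ltr k l → Ext k l
  ∞   : Ext k l

module _ {k l : ℕ} where

  rank : Ext k l → ℕ
  rank (fin (un a)) = toℕ a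
  rank (fin (pr b)) = k + toℕ b
  rank ∞            = k + l

  _<ₑ_ : Ext k l → Ext k l → Set
  a <ₑ b = rank a < rank b

  _≤ₑ_ : Ext k l → Ext k l → Set
  a ≤ₑ b = rank a ≤ rank b

  _<?ₑ_ : Ext k l → Ext k l → Bool
  a <?ₑ b = rank a <ᵇ rank b

  _≤?ₑ_ : Ext k l → Ext k l → Bool
  a ≤?ₑ b = rank a ≤ᵇ rank b

  data IsUn : Ext k l → Set where
    isUn : ∀ a → IsUn (fin (un a))

  data IsPr : Ext k l → Set where
    isPr : ∀ b → IsPr (fin (pr b))

-- A filling: list of rows, bottom row first (French notation); row i is the
-- list of its entries from left to right.  Row i of the list (0-based) is
-- row i+1 of the paper; column c (0-based) is column c+1 of the paper.
Tab : ℕ → ℕ → Set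
Tab k l = List (List (Ltr k l))

module _ {A : Set} where
  nth : List A → ℕ → Maybe A
  nth []       _       = nothing
  nth (x ∷ xs) zero    = just x
  nth (x ∷ xs) (suc n) = nth xs n

  setAt : List A → ℕ → A → List A
  setAt []       _       x = x ∷ []
  setAt (y ∷ ys) zero    x = x ∷ ys
  setAt (y ∷ ys) (suc c) x = y ∷ setAt ys c x

  modifyAt : List A → ℕ → (A → A) → List A
  modifyAt []       _       f = []
  modifyAt (y ∷ ys) zero    f = f y ∷ ys
  modifyAt (y ∷ ys) (suc n) f = y ∷ modifyAt ys n f

  insertAt : List A → ℕ → A → List A
  insertAt xs       zero    x = x ∷ xs
  insertAt []       (suc n) x = x ∷ []
  insertAt (y ∷ ys) (suc n) x = y ∷ insertAt ys n x

module _ {k l : ℕ} where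

  -- the padded array F̂ : entry (i , c), ∞ on missing cells
  entry : Tab k l → ℕ → ℕ → Ext k l
  entry T i c with nth T i
  ... | nothing  = ∞
  ... | just row with nth row c
  ...   | nothing = ∞
  ...   | just a  = fin a

  rowLen : Tab k l → ℕ → ℕ
  rowLen T i with nth T i
  ... | nothing  = 0
  ... | just row = length row

  shape : Tab k l → List ℕ
  shape T = map length T

  maxPart : Tab k l → ℕ
  maxPart T = foldr _⊔_ 0 (shape T)

  RowStep : Ext k l → Ext k l → Set
  RowStep a b = a <ₑ b ⊎ (a ≡ b × IsUn a)

  ColStep : Ext k l → Ext k l → Set
  ColStep a b = a <ₑ b ⊎ (a ≡ b × IsPr a)

  record IsHCT (T : Tab k l) : Set where
    field
      -- the shape is a composition: all parts positive
      rowsNonempty : ∀ i → i < length T → 0 < rowLen T i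
      rowCond : ∀ i c → i < length T → suc c < rowLen T i →
                RowStep (entry T i c) (entry T i (suc c))
      colCond : ∀ i → suc i < length T →
                ColStep (entry T i 0) (entry T (suc i) 0)
      -- conditions (a) and (b); here (n , n+1) are 0-based columns, i.e. paper's
      -- columns n+1, n+2 with 1 ≤ n+1 < m
      condA : ∀ i j n → i < j → j < length T → suc n < maxPart T →
              IsUn (entry T i (suc n)) →
              entry T j n ≤ₑ entry T i (suc n) →
              entry T j (suc n) <ₑ entry T i (suc n)
      condB : ∀ i j n → i < j → j < length T → suc n < maxPart T →
              IsPr (entry T i (suc n)) →
              entry T j n <ₑ entry T i (suc n) →
              entry T j (suc n) ≤ₑ entry T i (suc n)

  -- cells (i , c) with c ≠ 0 of the padded array (columns 1..m, 0-based,
  -- i.e. paper's columns 2..m+1) in reading order: columns right to left,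
  -- each column top to bottom.
  readingCells : ℕ → ℕ → List (ℕ × ℕ)
  readingCells r m =
    concatMap (λ c → map (λ i → (i , c)) (reverse (upTo r)))
              (reverse (map suc (upTo m)))

  bumps : Ltr k l → Ext k l → Ext k l → Bool
  bumps (un a) e lft = (fin (un a) <?ₑ e) ∧ (lft ≤?ₑ fin (un a))
  bumps (pr b) e lft = (fin (pr b) ≤?ₑ e) ∧ (lft <?ₑ fin (pr b))

  below : Ltr k l → Ext k l → Bool
  below (un a) e = fin (un a) <?ₑ e
  below (pr b) e = fin (pr b) ≤?ₑ e

  headE : List (Ltr k l) → Ext k l
  headE []      = ∞
  headE (a ∷ _) = fin a

  newRowPos : Tab k l → Ltr k l → ℕ
  newRowPos []          x = 0
  newRowPos (row ∷ rows) x =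
    if below x (headE row) then 0 else suc (newRowPos rows x)

  setCell : Tab k l → ℕ → ℕ → Ltr k l → Tab k l
  setCell T i c x = modifyAt T i (λ row → setAt row c x)

  -- result: new tableau, and position of the newly created row (if any)
  insLoop : Tab k l → Ltr k l → List (ℕ × ℕ) → Tab k l × Maybe ℕ
  insLoop T x [] = insertAt T (newRowPos T x) (x ∷ []) , just (newRowPos T x)
  insLoop T x ((i , c) ∷ ps) with bumps x (entry T i c) (entry T i (pred c))
  ... | false = insLoop T x ps
  ... | true with entry T i c
  ...   | ∞     = setCell T i c x , nothing
  ...   | fin y = insLoop (setCell T i c x) y ps

  insert : Tab k l → Ltr k l → Tab k l × Maybe ℕ
  insert T x = insLoop T x (readingCells (length T) (maxPart T))

  _⟵_ : Tab k l → Ltr k l → Tab k l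
  T ⟵ x = proj₁ (insert T x)

  -- index in T ← x of the row that was row i of T
  newIndex : Tab k l → Ltr k l → ℕ → ℕ
  newIndex T x i with proj₂ (insert T x)
  ... | nothing = i
  ... | just p  = if i <ᵇ p then i else suc i

module Submission where

-- The insertion scan only overwrites existing cells, except at its last step,
-- which either creates a new row (old rows keep their lengths) or writes the
-- carried letter into a missing cell, lengthening one row by one.  So a gap
-- β_i ≥ β_j + 2 survives, and for β_i = β_j + 1 it suffices that row j does not
-- grow.  For that, follow the scan: once the carried letter has passed the missing
-- cell after row i without bumping it, it is ⊑ V, the last entry of row i;
-- conditions (a),(b) keep every letter bumped afterwards ⊑ V until the missing cell
-- after row j is reached, and bumping that cell would need F(j,β_j) below V, which
-- (a),(b) forbid.

open import Defs
open import Data.Nat.Base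
open import Data.Nat.Properties
open import Data.Bool.Base using (true; false; T; if_then_else_)
open import Data.Bool.Properties using (T-∧; T-≡)
open import Data.Empty using (⊥-elim)
open import Data.Unit.Base using (⊤; tt)
open import Data.Fin.Base using (Fin; toℕ)
open import Data.Fin.Properties using (toℕ<n)
open import Data.List.Base using (List; []; _∷_; length; map; concatMap; reverse; upTo; downFrom)
open import Data.List.Properties using (length-map; reverse-upTo; reverse-map; ∷-injectiveˡ; ∷-injectiveʳ)
open import Data.List.Relation.Unary.All using (All; []; _∷_)
import Data.List.Relation.Unary.All as All
import Data.List.Relation.Unary.All.Properties as All
open import Data.List.Relation.Unary.AllPairs using (AllPairs; []; _∷_)
import Data.List.Relation.Unary.AllPairs.Properties as AllPairs
open import Data.List.Relation.Unary.Any using (here; there)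
open import Data.List.Membership.Propositional using (_∈_)
open import Data.List.Membership.Propositional.Properties using (∈-map⁺; ∈-concat⁺′; ∈-downFrom⁺)
open import Data.Maybe.Base using (Maybe; just; nothing; maybe′; fromMaybe)
open import Data.Product.Base using (_×_; _,_; proj₁; proj₂)
open import Data.Sum.Base using (_⊎_; inj₁; inj₂)
open import Function.Base using (id)
open import Function.Bundles using (Equivalence)
open import Relation.Nullary using (¬_)
open import Relation.Binary.Definitions using (tri<; tri≈; tri>)
open import Relation.Binary.PropositionalEquality

module _ {A : Set} where

  setAt-length : ∀ (xs : List A) b x → b < length xs → length (setAt xs b x) ≡ length xs
  setAt-length []       b       x ()
  setAt-length (y ∷ ys) zero    x _         = refl
  setAt-length (y ∷ ys) (suc b) x (s≤s b<n) = cong suc (setAt-length ys b x b<n)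

  setAt-length-≥ : ∀ (xs : List A) b x → length xs ≤ length (setAt xs b x)
  setAt-length-≥ []       b       x = z≤n
  setAt-length-≥ (y ∷ ys) zero    x = ≤-refl
  setAt-length-≥ (y ∷ ys) (suc b) x = s≤s (setAt-length-≥ ys b x)

  setAt-length-≤ : ∀ (xs : List A) b x → length (setAt xs b x) ≤ suc (length xs)
  setAt-length-≤ []       b       x = ≤-refl
  setAt-length-≤ (y ∷ ys) zero    x = n≤1+n _
  setAt-length-≤ (y ∷ ys) (suc b) x = s≤s (setAt-length-≤ ys b x)

module _ {k l : ℕ} where

  rowOf : Tab k l → ℕ → List (Ltr k l)
  rowOf T p = fromMaybe [] (nth T p)

  cellOf : List (Ltr k l) → ℕ → Ext k l
  cellOf row q = maybe′ fin ∞ (nth row q)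

  rowLen-rowOf : ∀ (T : Tab k l) p → rowLen T p ≡ length (rowOf T p)
  rowLen-rowOf T p with nth T p
  ... | nothing = refl
  ... | just row = refl

  entry-cellOf : ∀ (T : Tab k l) p q → entry T p q ≡ cellOf (rowOf T p) q
  entry-cellOf T p q with nth T p
  ... | nothing = refl
  ... | just row with nth row q
  ...   | nothing = refl
  ...   | just a  = refl

  cellOf-∞ : ∀ row q → cellOf row q ≡ ∞ → length row ≤ q
  cellOf-∞ []        q       _  = z≤n
  cellOf-∞ (a ∷ row) zero    ()
  cellOf-∞ (a ∷ row) (suc q) e  = s≤s (cellOf-∞ row q e)

  cellOf-beyond : ∀ row q → length row ≤ q → cellOf row q ≡ ∞
  cellOf-beyond []        q       _         = refl
  cellOf-beyond (a ∷ row) (suc q) (s≤s le) = cellOf-beyond row q le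

  cellOf-setAt-other : ∀ row b x q → b < length row → q ≢ b →
                       cellOf (setAt row b x) q ≡ cellOf row q
  cellOf-setAt-other (a ∷ row) zero    x zero    _         q≢b = ⊥-elim (q≢b refl)
  cellOf-setAt-other (a ∷ row) zero    x (suc q) _         _   = refl
  cellOf-setAt-other (a ∷ row) (suc b) x zero    _         _   = refl
  cellOf-setAt-other (a ∷ row) (suc b) x (suc q) (s≤s b<n) q≢b =
    cellOf-setAt-other row b x q b<n (λ e → q≢b (cong suc e))

  entry-∞ : ∀ (T : Tab k l) p q → entry T p q ≡ ∞ → rowLen T p ≤ q
  entry-∞ T p q e =
    subst (_≤ q) (sym (rowLen-rowOf T p))
          (cellOf-∞ (rowOf T p) q (trans (sym (entry-cellOf T p q)) e))

  entry-beyond : ∀ (T : Tab k l) p q → rowLen T p ≤ q → entry T p q ≡ ∞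
  entry-beyond T p q le =
    trans (entry-cellOf T p q) (cellOf-beyond (rowOf T p) q (subst (_≤ q) (rowLen-rowOf T p) le))

  entry-≢∞ : ∀ (T : Tab k l) p q → entry T p q ≢ ∞ → q < rowLen T p
  entry-≢∞ T p q ne = ≰⇒> (λ le → ne (entry-beyond T p q le))

  entry-fin : ∀ (T : Tab k l) p q {a} → entry T p q ≡ fin a → q < rowLen T p
  entry-fin T p q e = entry-≢∞ T p q (λ e′ → fin≢∞ (trans (sym e) e′))
    where
    fin≢∞ : ∀ {a} → fin a ≢ ∞
    fin≢∞ ()

  rowLen-pos : ∀ (T : Tab k l) p → 0 < rowLen T p → p < length T
  rowLen-pos []        p       ()
  rowLen-pos (row ∷ T) zero    _   = s≤s z≤n
  rowLen-pos (row ∷ T) (suc p) pos = s≤s (rowLen-pos T p pos)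

  rowLen-≤-maxPart : ∀ (T : Tab k l) p → rowLen T p ≤ maxPart T
  rowLen-≤-maxPart []        p       = z≤n
  rowLen-≤-maxPart (row ∷ T) zero    = m≤m⊔n _ _
  rowLen-≤-maxPart (row ∷ T) (suc p) = ≤-trans (rowLen-≤-maxPart T p) (m≤n⊔m (length row) _)

  rowOf-modifyAt : ∀ (S : Tab k l) a f p →
                   rowOf (modifyAt S a f) p ≡ rowOf S p ⊎
                   (p ≡ a × rowOf (modifyAt S a f) p ≡ f (rowOf S p))
  rowOf-modifyAt []        a       f p       = inj₁ refl
  rowOf-modifyAt (row ∷ S) zero    f zero    = inj₂ (refl , refl)
  rowOf-modifyAt (row ∷ S) zero    f (suc p) = inj₁ refl
  rowOf-modifyAt (row ∷ S) (suc a) f zero    = inj₁ refl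
  rowOf-modifyAt (row ∷ S) (suc a) f (suc p) with rowOf-modifyAt S a f p
  ... | inj₁ same           = inj₁ same
  ... | inj₂ (refl , moved) = inj₂ (refl , moved)

  setCell-shape : ∀ (S : Tab k l) a b x → b < rowLen S a → shape (setCell S a b x) ≡ shape S
  setCell-shape []        a       b x ()
  setCell-shape (row ∷ S) zero    b x b<n = cong (_∷ shape S) (setAt-length row b x b<n)
  setCell-shape (row ∷ S) (suc a) b x b<n = cong (length row ∷_) (setCell-shape S a b x b<n)

  setCell-entry-other : ∀ (S : Tab k l) a b x p q → b < rowLen S a → (p , q) ≢ (a , b) →
                        entry (setCell S a b x) p q ≡ entry S p q
  setCell-entry-other S a b x p q b<n ne
    rewrite entry-cellOf (setCell S a b x) p q | entry-cellOf S p q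
    with rowOf-modifyAt S a (λ row → setAt row b x) p
  ... | inj₁ same          = cong (λ row → cellOf row q) same
  ... | inj₂ (refl , moved) =
    trans (cong (λ row → cellOf row q) moved)
          (cellOf-setAt-other (rowOf S p) b x q (subst (b <_) (rowLen-rowOf S p) b<n)
                              (λ q≡b → ne (cong (p ,_) q≡b)))

  setCell-rowLen-other : ∀ (S : Tab k l) a b x p → p ≢ a →
                         rowLen (setCell S a b x) p ≡ rowLen S p
  setCell-rowLen-other S a b x p p≢a
    rewrite rowLen-rowOf (setCell S a b x) p | rowLen-rowOf S p
    with rowOf-modifyAt S a (λ row → setAt row b x) p
  ... | inj₁ same          = cong length same
  ... | inj₂ (p≡a , _)     = ⊥-elim (p≢a p≡a)

  setCell-rowLen-bounds : ∀ (S : Tab k l) a b x p →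
                          rowLen S p ≤ rowLen (setCell S a b x) p ×
                          rowLen (setCell S a b x) p ≤ suc (rowLen S p)
  setCell-rowLen-bounds S a b x p
    rewrite rowLen-rowOf (setCell S a b x) p | rowLen-rowOf S p
    with rowOf-modifyAt S a (λ row → setAt row b x) p
  ... | inj₁ same =
    ≤-reflexive (sym (cong length same)) , ≤-trans (≤-reflexive (cong length same)) (n≤1+n _)
  ... | inj₂ (_ , moved) rewrite moved =
    setAt-length-≥ (rowOf S p) b x , setAt-length-≤ (rowOf S p) b x

  shape-length : ∀ (S T : Tab k l) → shape S ≡ shape T → length S ≡ length T
  shape-length S T eq = trans (sym (length-map length S)) (trans (cong length eq) (length-map length T))

  shape-rowLen : ∀ (S T : Tab k l) → shape S ≡ shape T → ∀ p → rowLen S p ≡ rowLen T p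
  shape-rowLen []        []        eq p       = refl
  shape-rowLen (r ∷ S)   (t ∷ T)   eq zero    = ∷-injectiveˡ eq
  shape-rowLen (r ∷ S)   (t ∷ T)   eq (suc p) = shape-rowLen S T (∷-injectiveʳ eq) p

relabel : Maybe ℕ → ℕ → ℕ
relabel nothing  q = q
relabel (just p) q = if q <ᵇ p then q else suc q

module _ {k l : ℕ} where

  rowOf-insertAt : ∀ (S : Tab k l) p row q → q < length S →
                   rowOf (insertAt S p row) (relabel (just p) q) ≡ rowOf S q
  rowOf-insertAt (r ∷ S) zero    row q       _         = refl
  rowOf-insertAt (r ∷ S) (suc p) row zero    _         = refl
  rowOf-insertAt (r ∷ S) (suc p) row (suc q) (s≤s q<n)
    with q <ᵇ p | rowOf-insertAt S p row q q<n
  ... | true  | moved = moved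
  ... | false | moved = moved

  insertAt-rowLen : ∀ (S : Tab k l) p row q → q < length S →
                    rowLen (insertAt S p row) (relabel (just p) q) ≡ rowLen S q
  insertAt-rowLen S p row q q<n = begin
    rowLen (insertAt S p row) (relabel (just p) q)
      ≡⟨ rowLen-rowOf (insertAt S p row) _ ⟩
    length (rowOf (insertAt S p row) (relabel (just p) q))
      ≡⟨ cong length (rowOf-insertAt S p row q q<n) ⟩
    length (rowOf S q)
      ≡⟨ sym (rowLen-rowOf S q) ⟩
    rowLen S q ∎
    where open ≡-Reasoning

  newIndex-relabel : ∀ (T : Tab k l) x q → newIndex T x q ≡ relabel (proj₂ (insert T x)) q
  newIndex-relabel T x q with proj₂ (insert T x)
  ... | nothing = refl
  ... | just p  = refl

module _ {k l : ℕ} where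

  rank-fin< : ∀ (y : Ltr k l) → rank (fin y) < k + l
  rank-fin< (un α) = <-≤-trans (toℕ<n α) (m≤m+n k l)
  rank-fin< (pr β) = +-monoʳ-< k (toℕ<n β)

  un<pr : ∀ {e : Ext k l} (β : Fin l) → IsUn e → e <ₑ fin (pr β)
  un<pr β (isUn α) = <-≤-trans (toℕ<n α) (m≤m+n k (toℕ β))

  -- e ⊑ v : e ≤ v, strictly if e is unprimed.  A letter x passes a missing cell
  -- whose left neighbour is v without bumping it exactly when fin x ⊑ v.
  _⊑_ : Ext k l → Ext k l → Set
  e ⊑ v = e ≤ₑ v × (IsUn e → e <ₑ v)

  ⊑-∞ : ∀ (e : Ext k l) → e ⊑ ∞
  ⊑-∞ (fin y) = <⇒≤ (rank-fin< y) , λ _ → rank-fin< y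
  ⊑-∞ ∞       = ≤-refl , λ ()

  ∞-⊑ : ∀ (v : Ext k l) → ∞ ⊑ v → v ≡ ∞
  ∞-⊑ (fin y) (le , _) = ⊥-elim (<⇒≱ (rank-fin< y) le)
  ∞-⊑ ∞       _        = refl

  Bumps : Ltr k l → Ext k l → Ext k l → Set
  Bumps (un α) e lft = fin (un α) <ₑ e × lft ≤ₑ fin (un α)
  Bumps (pr β) e lft = fin (pr β) ≤ₑ e × lft <ₑ fin (pr β)

  BumpsAt : Tab k l → Ltr k l → ℕ → ℕ → Set
  BumpsAt T x a b = Bumps x (entry T a b) (entry T a (pred b))

  bumps-true : ∀ x e lft → bumps x e lft ≡ true → Bumps x e lft
  bumps-true (un α) e lft eq with Equivalence.to T-∧ (Equivalence.from T-≡ eq)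
  ... | x<e , lft≤x = <ᵇ⇒< _ _ x<e , ≤ᵇ⇒≤ _ _ lft≤x
  bumps-true (pr β) e lft eq with Equivalence.to T-∧ (Equivalence.from T-≡ eq)
  ... | x≤e , lft<x = ≤ᵇ⇒≤ _ _ x≤e , <ᵇ⇒< _ _ lft<x

  bumps-false : ∀ x e lft → bumps x e lft ≡ false → ¬ Bumps x e lft
  bumps-false (un α) e lft eq (x<e , lft≤x) =
    subst T eq (Equivalence.from T-∧ (<⇒<ᵇ x<e , ≤⇒≤ᵇ lft≤x))
  bumps-false (pr β) e lft eq (x≤e , lft<x) =
    subst T eq (Equivalence.from T-∧ (≤⇒≤ᵇ x≤e , <⇒<ᵇ lft<x))

  no-bump-after-∞ : ∀ x (e : Ext k l) → ¬ Bumps x e ∞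
  no-bump-after-∞ (un α) e (_ , ∞≤x) = <⇒≱ (rank-fin< (un α)) ∞≤x
  no-bump-after-∞ (pr β) e (_ , ∞<x) = <-asym (rank-fin< (pr β)) ∞<x

  pass-∞ : ∀ x (v : Ext k l) → ¬ Bumps x ∞ v → fin x ⊑ v
  pass-∞ (un α) v nb = <⇒≤ x<v , λ _ → x<v
    where x<v = ≰⇒> (λ v≤x → nb (rank-fin< (un α) , v≤x))
  pass-∞ (pr β) v nb = ≮⇒≥ (λ v<x → nb (<⇒≤ (rank-fin< (pr β)) , v<x)) , λ ()

  bump-left-< : ∀ x (e lft v : Ext k l) → Bumps x e lft → fin x ⊑ v → lft <ₑ v
  bump-left-< (un α) e lft v (_ , lft≤x) (_ , x<v) = ≤-<-trans lft≤x (x<v (isUn α))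
  bump-left-< (pr β) e lft v (_ , lft<x) (x≤v , _) = <-≤-trans lft<x x≤v

module _ {k l : ℕ} {T : Tab k l} (hct : IsHCT T) where
  open IsHCT hct

  hct-dominance : ∀ {i a n} → i < a → a < length T → suc n < maxPart T →
                  entry T a n <ₑ entry T i (suc n) → entry T a (suc n) ⊑ entry T i (suc n)
  hct-dominance {i} {a} {n} i<a a<r n<m left< with entry T i (suc n) in eqV
  ... | ∞          = ⊑-∞ (entry T a (suc n))
  ... | fin (un α) = <⇒≤ bound , λ _ → bound
    where
    bound : entry T a (suc n) <ₑ fin (un α)
    bound = subst (entry T a (suc n) <ₑ_) eqV
              (condA i a n i<a a<r n<m (subst IsUn (sym eqV) (isUn α))
                     (subst (entry T a n ≤ₑ_) (sym eqV) (<⇒≤ left<)))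
  ... | fin (pr β) = bound , un<pr β
    where
    bound : entry T a (suc n) ≤ₑ fin (pr β)
    bound = subst (entry T a (suc n) ≤ₑ_) eqV
              (condB i a n i<a a<r n<m (subst IsPr (sym eqV) (isPr β))
                     (subst (entry T a n <ₑ_) (sym eqV) left<))

  hct-end : ∀ {a i n y} → a < i → i < length T → entry T i (suc n) ≡ ∞ →
            entry T a (suc n) ≡ fin y → fin y ⊑ entry T i n
  hct-end {a} {i} {n} {un α} a<i i<r end ey = <⇒≤ y<v , λ _ → y<v
    where
    y<v : fin (un α) <ₑ entry T i n
    y<v = ≰⇒> λ v≤y → <⇒≱ (rank-fin< (un α))
            (<⇒≤ (subst₂ _<ₑ_ end ey
              (condA a i n a<i i<r (<-≤-trans (entry-fin T a (suc n) ey) (rowLen-≤-maxPart T a))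
                     (subst IsUn (sym ey) (isUn α)) (subst (entry T i n ≤ₑ_) (sym ey) v≤y))))
  hct-end {a} {i} {n} {pr β} a<i i<r end ey = y≤v , λ ()
    where
    y≤v : fin (pr β) ≤ₑ entry T i n
    y≤v = ≮⇒≥ λ v<y → <⇒≱ (rank-fin< (pr β))
            (subst₂ _≤ₑ_ end ey
              (condB a i n a<i i<r (<-≤-trans (entry-fin T a (suc n) ey) (rowLen-≤-maxPart T a))
                     (subst IsPr (sym ey) (isPr β)) (subst (entry T i n <ₑ_) (sym ey) v<y)))

Cell : Set
Cell = ℕ × ℕ

Earlier : Cell → Cell → Set
Earlier (p , q) (a , b) = b < q ⊎ (q ≡ b × a < p)

earlier-irrefl : ∀ e → ¬ Earlier e e
earlier-irrefl (p , q) (inj₁ q<q)       = <-irrefl refl q<q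
earlier-irrefl (p , q) (inj₂ (_ , p<p)) = <-irrefl refl p<p

earlier-trans : ∀ {e f g} → Earlier e f → Earlier f g → Earlier e g
earlier-trans (inj₁ b<q)         (inj₁ d<b)         = inj₁ (<-trans d<b b<q)
earlier-trans (inj₁ b<q)         (inj₂ (refl , _))  = inj₁ b<q
earlier-trans (inj₂ (refl , _))  (inj₁ d<b)         = inj₁ d<b
earlier-trans (inj₂ (refl , a<p)) (inj₂ (refl , c<a)) = inj₂ (refl , <-trans c<a a<p)

earlier-cmp : ∀ e f → Earlier e f ⊎ e ≡ f ⊎ Earlier f e
earlier-cmp (p , q) (a , b) with <-cmp q b
... | tri< q<b _ _ = inj₂ (inj₂ (inj₁ q<b))
... | tri> _ _ b<q = inj₁ (inj₁ b<q)
... | tri≈ _ refl _ with <-cmp p a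
...   | tri< p<a _ _ = inj₂ (inj₂ (inj₂ (refl , p<a)))
...   | tri≈ _ refl _ = inj₂ (inj₁ refl)
...   | tri> _ _ a<p = inj₁ (inj₂ (refl , a<p))

Sorted : List Cell → Set
Sorted = AllPairs Earlier

sorted-tail : ∀ {h ps} → Sorted (h ∷ ps) → Sorted ps
sorted-tail (_ ∷ srt) = srt

-- While the cells ps remain to be scanned, the cells already scanned are those
-- read before the first remaining one (all of them once nothing remains).
Visited : List Cell → Cell → Set
Visited []      e = ⊤
Visited (h ∷ _) e = Earlier e h

visited-head : ∀ {h ps} → Sorted (h ∷ ps) → Visited ps h
visited-head {ps = []}     _                = tt
visited-head {ps = _ ∷ _} ((h<h′ ∷ _) ∷ _) = h<h′

visited-step : ∀ {h ps e} → Sorted (h ∷ ps) → Visited (h ∷ ps) e → Visited ps e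
visited-step {ps = []}     _                e<h = tt
visited-step {ps = _ ∷ _} ((h<h′ ∷ _) ∷ _) e<h = earlier-trans e<h h<h′

unvisited-after : ∀ {h ps e} → Sorted (h ∷ ps) → ¬ Visited ps e → Earlier h e
unvisited-after {h} {[]}     _                nv = ⊥-elim (nv tt)
unvisited-after {h} {_ ∷ _} {e} ((h<h′ ∷ _) ∷ _) nv with earlier-cmp e h
... | inj₁ e<h         = ⊥-elim (nv (earlier-trans e<h h<h′))
... | inj₂ (inj₁ refl) = ⊥-elim (nv h<h′)
... | inj₂ (inj₂ h<e)  = h<e

pending-unvisited : ∀ {ps e} → Sorted ps → e ∈ ps → ¬ Visited ps e
pending-unvisited {h ∷ _} _          (here refl) e<h = earlier-irrefl h e<h
pending-unvisited {h ∷ _} (h< ∷ _)  (there e∈) e<h =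
  earlier-irrefl _ (earlier-trans e<h (All.lookup h< e∈))

column : ℕ → ℕ → List Cell
column r c = map (λ p → (p , c)) (downFrom r)

module _ {k l : ℕ} where

  readingCells-columns : ∀ r m →
                         readingCells {k} {l} r m ≡ concatMap (column r) (map suc (downFrom m))
  readingCells-columns r m =
    cong₂ (λ rows cols → concatMap (λ c → map (λ p → (p , c)) rows) cols)
          (reverse-upTo r)
          (trans (sym (reverse-map suc (upTo m))) (cong (map suc) (reverse-upTo m)))

  readingCells-sorted : ∀ r m → Sorted (readingCells {k} {l} r m)
  readingCells-sorted r m rewrite readingCells-columns r m =
    AllPairs.concat⁺ (All.map⁺ (All.universal (λ _ → column-sorted) _))
      (AllPairs.map⁺ (AllPairs.map⁺ (AllPairs.applyDownFrom⁺₁ id m columns-ordered)))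
    where
    column-sorted : ∀ {c} → Sorted (column r c)
    column-sorted =
      AllPairs.map⁺ (AllPairs.applyDownFrom⁺₁ id r (λ q<p _ → inj₂ (refl , q<p)))
    columns-ordered : ∀ {c c′} → c′ < c → c < m →
                      All (λ e → All (Earlier e) (column r (suc c′))) (column r (suc c))
    columns-ordered c′<c _ =
      All.map⁺ (All.universal (λ _ → All.map⁺ (All.universal (λ _ → inj₁ (s≤s c′<c)) _)) _)

  readingCells-complete : ∀ {r m p q} → p < r → 0 < q → q ≤ m →
                          (p , q) ∈ readingCells {k} {l} r m
  readingCells-complete {r} {m} {p} {suc q} p<r _ q<m rewrite readingCells-columns r m =
    ∈-concat⁺′ (∈-map⁺ (λ p → (p , suc q)) (∈-downFrom⁺ p<r))
               (∈-map⁺ (column r) (∈-map⁺ suc (∈-downFrom⁺ q<m)))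

left-not-earlier : ∀ a b → ¬ Earlier (a , pred b) (a , b)
left-not-earlier a b (inj₁ b<b-1)      = <⇒≱ b<b-1 (pred[n]≤n {b})
left-not-earlier a b (inj₂ (_ , a<a)) = <-irrefl refl a<a

-- How an insertion run can end, for an invariant Q on (remaining cells, carried
-- letter): the carried letter y starts a new row, or y bumps the missing cell
-- (a , b) of T while Q holds there.
data Outcome {k l : ℕ} (T : Tab k l) (Q : List Cell → Ltr k l → Set) :
             Tab k l × Maybe ℕ → Set where
  newRow : ∀ {S} p y → shape S ≡ shape T → Outcome T Q (insertAt S p (y ∷ []) , just p)
  extend : ∀ {S} a b y ps → shape S ≡ shape T → entry T a b ≡ ∞ → BumpsAt T y a b →
           Q ((a , b) ∷ ps) y → Outcome T Q (setCell S a b y , nothing)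

-- Q must survive every step, stated in terms of the
-- entries of the original filling T: scanning a cell without bumping it (skip),
-- and bumping its entry y, which is carried on (carry).
module Run {k l : ℕ} (T : Tab k l) (Q : List Cell → Ltr k l → Set)
  (skip  : ∀ {a b ps x} → Sorted ((a , b) ∷ ps) → ¬ BumpsAt T x a b →
           Q ((a , b) ∷ ps) x → Q ps x)
  (carry : ∀ {a b ps x y} → Sorted ((a , b) ∷ ps) → BumpsAt T x a b →
           entry T a b ≡ fin y → Q ((a , b) ∷ ps) x → Q ps y) where

  -- S agrees with T on the cells not yet visited: each cell is written at most once.
  record Agrees (S : Tab k l) (ps : List Cell) : Set where
    field unvisited : ∀ p q → ¬ Visited ps (p , q) → entry S p q ≡ entry T p q
  open Agrees

  -- The scanned cell and its left neighbour are unvisited, so the bumping test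
  -- reads the entries of T there.
  scanned-agrees : ∀ {S a b ps} → Agrees S ((a , b) ∷ ps) → entry S a b ≡ entry T a b
  scanned-agrees {a = a} {b} agr = unvisited agr a b (earlier-irrefl _)

  left-agrees : ∀ {S a b ps} → Agrees S ((a , b) ∷ ps) →
                entry S a (pred b) ≡ entry T a (pred b)
  left-agrees {a = a} {b} agr = unvisited agr a (pred b) (left-not-earlier a b)

  bump-in-T : ∀ {S a b ps x e} → Agrees S ((a , b) ∷ ps) → e ≡ entry T a b →
              bumps x e (entry S a (pred b)) ≡ true → BumpsAt T x a b
  bump-in-T {x = x} agr e≡ eqb = subst₂ (Bumps x) e≡ (left-agrees agr) (bumps-true x _ _ eqb)

  -- Agreement survives a step: only the scanned cell, now visited, may be written.
  agrees-step : ∀ {S h ps} → Sorted (h ∷ ps) → Agrees S (h ∷ ps) → Agrees S ps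
  agrees-step srt agr =
    record { unvisited = λ p q nv → unvisited agr p q (λ v → nv (visited-step srt v)) }

  agrees-setCell : ∀ {S a b x ps} → Sorted ((a , b) ∷ ps) → b < rowLen S a →
                   Agrees S ((a , b) ∷ ps) → Agrees (setCell S a b x) ps
  agrees-setCell {S} {a} {b} {x} srt b<n agr = record { unvisited = λ p q nv →
    trans (setCell-entry-other S a b x p q b<n (λ { refl → nv (visited-head srt) }))
          (unvisited (agrees-step srt agr) p q nv) }

  run : ∀ S x ps → Sorted ps → shape S ≡ shape T → Agrees S ps → Q ps x →
        Outcome T Q (insLoop S x ps)
  run S x []             _   sh _   inv = newRow (newRowPos S x) x sh
  run S x ((a , b) ∷ ps) srt sh agr inv with bumps x (entry S a b) (entry S a (pred b)) in eqb
  ... | false = run S x ps (sorted-tail srt) sh (agrees-step srt agr) (skip srt no-bump inv)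
    where
    no-bump : ¬ BumpsAt T x a b
    no-bump = subst₂ (λ e lft → ¬ Bumps x e lft) (scanned-agrees agr) (left-agrees agr)
                     (bumps-false x _ _ eqb)
  ... | true with entry S a b in eqe
  ...   | ∞     = extend a b x ps sh (sym eT) (bump-in-T agr eT eqb) inv
    where
    eT : ∞ ≡ entry T a b
    eT = trans (sym eqe) (scanned-agrees agr)
  ...   | fin y = run (setCell S a b x) y ps (sorted-tail srt) (trans (setCell-shape S a b x b<n) sh)
                    (agrees-setCell srt b<n agr) (carry srt (bump-in-T agr eT eqb) (sym eT) inv)
    where
    b<n : b < rowLen S a
    b<n = entry-fin S a b eqe
    eT : fin y ≡ entry T a b
    eT = trans (sym eqe) (scanned-agrees agr)

  insert-outcome : ∀ x → Q (readingCells {k} {l} (length T) (maxPart T)) x →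
                   Outcome T Q (insert T x)
  insert-outcome x inv = run T x _ (readingCells-sorted {k} {l} (length T) (maxPart T)) refl
                                (record { unvisited = λ _ _ _ → refl }) inv

module _ {k l : ℕ} {T : Tab k l} {Q : List Cell → Ltr k l → Set} where

  newRowLen : Tab k l × Maybe ℕ → ℕ → ℕ
  newRowLen R q = rowLen (proj₁ R) (relabel (proj₂ R) q)

  newRow-rowLen : ∀ {S q} p row → shape S ≡ shape T → q < length T →
                  rowLen (insertAt S p row) (relabel (just p) q) ≡ rowLen T q
  newRow-rowLen {S} {q} p row sh q<r =
    trans (insertAt-rowLen S p row q (subst (q <_) (sym (shape-length S T sh)) q<r))
          (shape-rowLen S T sh q)

  outcome-rowLen-bounds : ∀ {R} → Outcome T Q R → ∀ q → q < length T →
                          rowLen T q ≤ newRowLen R q × newRowLen R q ≤ suc (rowLen T q)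
  outcome-rowLen-bounds (newRow {S} p y sh) q q<r =
    ≤-reflexive (sym same) , ≤-trans (≤-reflexive same) (n≤1+n _)
    where same = newRow-rowLen p (y ∷ []) sh q<r
  outcome-rowLen-bounds (extend {S} a b y ps sh _ _ _) q _
    rewrite sym (shape-rowLen S T sh q) = setCell-rowLen-bounds S a b y q

  outcome-rowLen-stable : ∀ {R} → Outcome T Q R → ∀ q → q < length T →
                          (∀ {b y ps} → entry T q b ≡ ∞ → BumpsAt T y q b →
                                        ¬ Q ((q , b) ∷ ps) y) →
                          newRowLen R q ≡ rowLen T q
  outcome-rowLen-stable (newRow p y sh) q q<r _ = newRow-rowLen p (y ∷ []) sh q<r
  outcome-rowLen-stable (extend {S} a b y ps sh end bump inv) q _ excluded =
    trans (setCell-rowLen-other S a b y q q≢a) (shape-rowLen S T sh q)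
    where
    q≢a : q ≢ a
    q≢a refl = excluded end bump inv

insert-rowLen-bounds : ∀ {k l} (T : Tab k l) x q → q < length T →
                       rowLen T q ≤ rowLen (T ⟵ x) (newIndex T x q) ×
                       rowLen (T ⟵ x) (newIndex T x q) ≤ suc (rowLen T q)
insert-rowLen-bounds T x q q<r rewrite newIndex-relabel T x q =
  outcome-rowLen-bounds
    (Run.insert-outcome T (λ _ _ → ⊤) (λ _ _ _ → tt) (λ _ _ _ _ → tt) x tt) q q<r

squeeze : ∀ {b c} → suc c ≤ b → pred b < suc c → b ≡ suc c
squeeze {suc b} (s≤s c≤b) (s≤s b≤c) = cong suc (≤-antisym b≤c c≤b)

-- The key case: rows i < j of an HCT with β_i = β_j + 1 = c′ + 2.  Let V be the last
-- entry of row i, start = (i , c′+2) the missing cell after it and stop = (j , c′+1)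
-- the missing cell after row j.  After start has been passed and before stop is
-- reached, the carried letter x satisfies fin x ⊑ V.  So bumping the missing cell
-- stop would need its left neighbour F(j,c′) below V, and then conditions (a),(b)
-- force F(j,c′+1) ⊑ V, impossible for the missing F(j,c′+1) = ∞.
module RowOneShorterAbove {k l : ℕ} {T : Tab k l} (hct : IsHCT T) {i j c′ : ℕ}
  (i<j : i < j) (j<r : j < length T)
  (row-j : rowLen T j ≡ suc c′) (row-i : rowLen T i ≡ suc (suc c′)) where

  V : Ext k l
  V = entry T i (suc c′)

  start stop : Cell
  start = (i , suc (suc c′))
  stop  = (j , suc c′)

  i<r : i < length T
  i<r = <-trans i<j j<r

  start-∞ : entry T i (suc (suc c′)) ≡ ∞
  start-∞ = entry-beyond T i _ (≤-reflexive row-i)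

  stop-∞ : entry T j (suc c′) ≡ ∞
  stop-∞ = entry-beyond T j _ (≤-reflexive row-j)

  V-fin : V ≢ ∞
  V-fin V∞ = <-irrefl refl (subst (_≤ suc c′) row-i (entry-∞ T i (suc c′) V∞))

  c′<m : suc c′ < maxPart T
  c′<m = <-≤-trans (subst (suc c′ <_) (sym row-i) ≤-refl) (rowLen-≤-maxPart T i)

  Pending : List Cell → Set
  Pending ps = Visited ps start ⊎ start ∈ ps

  Active : List Cell → Ltr k l → Set
  Active ps x = Visited ps start → ¬ Visited ps stop → fin x ⊑ V

  Phase : List Cell → Ltr k l → Set
  Phase ps x = Pending ps × Active ps x

  pending-step : ∀ {h ps} → Sorted (h ∷ ps) → Pending (h ∷ ps) → Pending ps
  pending-step srt (inj₁ visited)     = inj₁ (visited-step srt visited)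
  pending-step srt (inj₂ (here refl)) = inj₁ (visited-head srt)
  pending-step srt (inj₂ (there s∈))  = inj₂ s∈

  between : ∀ {a b} → Earlier start (a , b) → Earlier (a , b) stop →
            (b ≡ suc (suc c′) × a < i) ⊎ (b ≡ suc c′ × j < a)
  between (inj₁ b<c+2)       (inj₁ c+1<b)       = ⊥-elim (<⇒≱ c+1<b (s≤s⁻¹ b<c+2))
  between (inj₁ _)           (inj₂ (b≡ , j<a))  = inj₂ (b≡ , j<a)
  between (inj₂ (refl , a<i)) _                 = inj₁ (refl , a<i)

  carried-⊑ : ∀ {a b x y} → Earlier start (a , b) → Earlier (a , b) stop →
              BumpsAt T x a b → fin x ⊑ V → entry T a b ≡ fin y → fin y ⊑ V
  carried-⊑ {a} {b} {x} s<h h<t bump x⊑V ey with between s<h h<t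
  ... | inj₁ (refl , a<i) = hct-end hct a<i i<r start-∞ ey
  ... | inj₂ (refl , j<a) =
    subst (_⊑ V) ey (hct-dominance hct (<-trans i<j j<a) a<r c′<m (bump-left-< x _ _ V bump x⊑V))
    where
    a<r : a < length T
    a<r = rowLen-pos T a (≤-<-trans z≤n (entry-fin T a (suc c′) ey))

  active-skip : ∀ {a b ps x} → Sorted ((a , b) ∷ ps) → ¬ BumpsAt T x a b →
                Pending ((a , b) ∷ ps) → Active ((a , b) ∷ ps) x → Active ps x
  active-skip srt nb (inj₁ s<h)         active vs nt =
    active s<h (λ vt → nt (visited-step srt vt))
  active-skip {x = x} srt nb (inj₂ (here refl)) active vs nt =
    pass-∞ x V (subst (λ e → ¬ Bumps x e V) start-∞ nb)
  active-skip srt nb (inj₂ (there s∈))  active vs nt =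
    ⊥-elim (pending-unvisited (sorted-tail srt) s∈ vs)

  -- start itself is missing, so every bump inside the phase is one of carried-⊑.
  active-carry : ∀ {a b ps x y} → Sorted ((a , b) ∷ ps) → BumpsAt T x a b →
                 entry T a b ≡ fin y → Pending ((a , b) ∷ ps) → Active ((a , b) ∷ ps) x →
                 Active ps y
  active-carry srt bump ey (inj₁ s<h) active vs nt =
    carried-⊑ s<h (unvisited-after srt nt) bump (active s<h (λ vt → nt (visited-step srt vt))) ey
  active-carry srt bump ey (inj₂ (here refl)) active vs nt with trans (sym ey) start-∞
  ... | ()
  active-carry srt bump ey (inj₂ (there s∈)) active vs nt =
    ⊥-elim (pending-unvisited (sorted-tail srt) s∈ vs)

  phase-skip : ∀ {a b ps x} → Sorted ((a , b) ∷ ps) → ¬ BumpsAt T x a b →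
               Phase ((a , b) ∷ ps) x → Phase ps x
  phase-skip srt nb (pend , active) = pending-step srt pend , active-skip srt nb pend active

  phase-carry : ∀ {a b ps x y} → Sorted ((a , b) ∷ ps) → BumpsAt T x a b →
                entry T a b ≡ fin y → Phase ((a , b) ∷ ps) x → Phase ps y
  phase-carry srt bump ey (pend , active) =
    pending-step srt pend , active-carry srt bump ey pend active

  -- start is in the reading list, so the phase has not begun.
  phase-start : ∀ x → Phase (readingCells {k} {l} (length T) (maxPart T)) x
  phase-start x = inj₂ start∈ , λ vs → ⊥-elim (pending-unvisited sorted start∈ vs)
    where
    sorted : Sorted (readingCells {k} {l} (length T) (maxPart T))
    sorted = readingCells-sorted {k} {l} (length T) (maxPart T)
    start∈ : start ∈ readingCells {k} {l} (length T) (maxPart T)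
    start∈ = readingCells-complete {k} {l} i<r (s≤s z≤n)
                                   (subst (_≤ maxPart T) row-i (rowLen-≤-maxPart T i))

  final-at-stop : ∀ {b y} → entry T j b ≡ ∞ → BumpsAt T y j b → b ≡ suc c′
  final-at-stop {b} {y} end bump =
    squeeze (subst (_≤ b) row-j (entry-∞ T j b end))
            (subst (pred b <_) row-j (entry-≢∞ T j (pred b) left≢∞))
    where
    left≢∞ : entry T j (pred b) ≢ ∞
    left≢∞ left∞ = no-bump-after-∞ y _ (subst (Bumps y _) left∞ bump)

  no-final-bump-in-row-j : ∀ {b y ps} → entry T j b ≡ ∞ → BumpsAt T y j b →
                           ¬ Phase ((j , b) ∷ ps) y
  no-final-bump-in-row-j {y = y} end bump (_ , active) with final-at-stop end bump
  ... | refl = V-fin (∞-⊑ V (subst (_⊑ V) stop-∞ row-j-end⊑V))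
    where
    y⊑V : fin y ⊑ V
    y⊑V = active (inj₁ ≤-refl) (earlier-irrefl stop)
    row-j-end⊑V : entry T j (suc c′) ⊑ V
    row-j-end⊑V = hct-dominance hct i<j j<r c′<m (bump-left-< y _ _ V bump y⊑V)

  row-j-stable : ∀ x → rowLen (T ⟵ x) (newIndex T x j) ≡ rowLen T j
  row-j-stable x rewrite newIndex-relabel T x j =
    outcome-rowLen-stable (Run.insert-outcome T Phase phase-skip phase-carry x (phase-start x))
                          j j<r no-final-bump-in-row-j

-- Lemma 7.3.  A gap of two or more cannot close since each row grows by at most
-- one; a gap of exactly one is kept because row j does not grow at all.
lemma7p3 : {k l : ℕ} (T : Tab k l) (x : Ltr k l) → IsHCT T →
           (i j : ℕ) → i < j → j < length T → rowLen T j < rowLen T i →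
           rowLen (T ⟵ x) (newIndex T x j) < rowLen (T ⟵ x) (newIndex T x i)
lemma7p3 T x hct i j i<j j<r βj<βi with m≤n⇒m<n∨m≡n βj<βi
... | inj₁ gap = begin-strict
  rowLen (T ⟵ x) (newIndex T x j) ≤⟨ proj₂ (insert-rowLen-bounds T x j j<r) ⟩
  suc (rowLen T j)                 <⟨ gap ⟩
  rowLen T i                       ≤⟨ proj₁ (insert-rowLen-bounds T x i (<-trans i<j j<r)) ⟩
  rowLen (T ⟵ x) (newIndex T x i) ∎
  where open ≤-Reasoning
... | inj₂ tight = begin-strict
  rowLen (T ⟵ x) (newIndex T x j) ≡⟨ RowOneShorterAbove.row-j-stable hct i<j j<r row-j row-i x ⟩
  rowLen T j                       <⟨ βj<βi ⟩
  rowLen T i                       ≤⟨ proj₁ (insert-rowLen-bounds T x i (<-trans i<j j<r)) ⟩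
  rowLen (T ⟵ x) (newIndex T x i) ∎
  where
  open ≤-Reasoning
  row-j : rowLen T j ≡ suc (pred (rowLen T j))
  row-j = sym (suc-pred (rowLen T j) {{>-nonZero (IsHCT.rowsNonempty hct j j<r)}})
  row-i : rowLen T i ≡ suc (suc (pred (rowLen T j)))
  row-i = trans (sym tight) (cong suc row-j)
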